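{- Let $T_1$ and $T_2$ be circle-trees with disjoint vertex sets, and let $x\in T_1$, $y\in T_2$ with $\delta_{T_1}(x)=\delta_{T_2}(y)=2$. Then $T_1+_{x,y}T_2$ is a circle-tree.
   Context: All graphs are finite simple graphs. A circle is a finite connected graph in which every vertex has degree exactly $2$. For disjoint graphs $G,H$ with $\Delta(G),\Delta(H)\le3$ and vertices $x\in G$, $y\in H$ of degree $2$ in their respective graphs, $G+_{x,y}H$ is the disjoint union of $G$ and $H$ with the single extra edge $\{x,y\}$. A finite graph $T$ is a circle-tree if there are circles $C(0),\dots,C(k-1)$ ($k\ge1$) and graphs $T(0)=C(0)$, $T(i)=T(i-1)+_{x,y}C(i)$ for $0<i<k$ (with $C(i)$ disjoint from $T(i-1)$, $x\in T(i-1)$ of degree $2$ in $T(i-1)$, $y\in C(i)$), such that $T=T(k-1)$. -}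

module Defs where

open import Data.Nat using (ℕ; zero; suc; _+_; _<_)
open import Data.Bool using (Bool; true; false; _∧_; if_then_else_)
open import Data.Fin using (Fin; splitAt; _≟_)
open import Data.Sum using (_⊎_; inj₁; inj₂)
open import Data.Product using (_×_; Σ)
open import Data.List using (List; map)
open import Data.Nat.ListAction using (sum)
open import Data.List using () renaming (allFin to allFinL)
open import Relation.Nullary using (Dec; yes; no)
open import Relation.Nullary.Decidable using (⌊_⌋)
open import Relation.Binary.PropositionalEquality using (_≡_; refl)

record Graph : Set where
  field
    size   : ℕ
    adj    : Fin size → Fin size → Bool
    sym    : ∀ u v → adj u v ≡ adj v u
    irrefl : ∀ v → adj v v ≡ false
open Graph public

Vertex : Graph → Set
Vertex G = Fin (size G)

deg : (G : Graph) → Vertex G → ℕ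
deg G v = sum (map (λ w → if adj G v w then 1 else 0) (allFinL (size G)))

data Reachable (G : Graph) : Vertex G → Vertex G → Set where
  here : ∀ {u} → Reachable G u u
  step : ∀ {u w v} → adj G u w ≡ true → Reachable G w v → Reachable G u v

Connected : Graph → Set
Connected G = (0 < size G) × (∀ u v → Reachable G u v)

IsCircle : Graph → Set
IsCircle G = Connected G × (∀ v → deg G v ≡ 2)

record _≅_ (G H : Graph) : Set where
  field
    to      : Vertex G → Vertex H
    from    : Vertex H → Vertex G
    from-to : ∀ v → from (to v) ≡ v
    to-from : ∀ w → to (from w) ≡ w
    adj-pres : ∀ u v → adj H (to u) (to v) ≡ adj G u v

-- G +_{x,y} H : disjoint union of G and H (on Fin (|G| + |H|), the vertices
-- of G first) together with the single extra edge {x,y}.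
module _ (G H : Graph) (x : Vertex G) (y : Vertex H) where
  private
    adj⊎ : Vertex G ⊎ Vertex H → Vertex G ⊎ Vertex H → Bool
    adj⊎ (inj₁ a) (inj₁ b) = adj G a b
    adj⊎ (inj₂ a) (inj₂ b) = adj H a b
    adj⊎ (inj₁ a) (inj₂ b) = ⌊ a ≟ x ⌋ ∧ ⌊ b ≟ y ⌋
    adj⊎ (inj₂ b) (inj₁ a) = ⌊ a ≟ x ⌋ ∧ ⌊ b ≟ y ⌋

    adj⊎-sym : ∀ s t → adj⊎ s t ≡ adj⊎ t s
    adj⊎-sym (inj₁ a) (inj₁ b) = sym G a b
    adj⊎-sym (inj₂ a) (inj₂ b) = sym H a b
    adj⊎-sym (inj₁ a) (inj₂ b) = refl
    adj⊎-sym (inj₂ b) (inj₁ a) = refl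

    adj⊎-irrefl : ∀ s → adj⊎ s s ≡ false
    adj⊎-irrefl (inj₁ a) = irrefl G a
    adj⊎-irrefl (inj₂ a) = irrefl H a

  join : Graph
  join = record
    { size   = size G + size H
    ; adj    = λ u v → adj⊎ (splitAt (size G) u) (splitAt (size G) v)
    ; sym    = λ u v → adj⊎-sym (splitAt (size G) u) (splitAt (size G) v)
    ; irrefl = λ v → adj⊎-irrefl (splitAt (size G) v)
    }

infixl 6 _+[_,_]_
_+[_,_]_ : (G : Graph) → Vertex G → (H : Graph) → Vertex H → Graph
G +[ x , H ] y = join G H x y

-- Circle-trees: T(0) = C(0) a circle; T(i) = T(i-1) +_{x,y} C(i) with
-- x of degree 2 in T(i-1), y ∈ C(i), C(i) a circle.  Graphs are taken up
-- to isomorphism (vertex sets are Fin n here).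
data IsCircleTree (T : Graph) : Set where
  base : IsCircle T → IsCircleTree T
  grow : (T' C : Graph) (x : Vertex T') (y : Vertex C) →
         IsCircleTree T' → IsCircle C → deg T' x ≡ 2 →
         T ≅ (T' +[ x , C ] y) → IsCircleTree T

{-# OPTIONS --safe #-}
-- Induction on the construction of T₂.  If T₂ is a circle, T₁ +_{x,y} T₂ is one growth step
-- of T₁.  Otherwise T₂ ≅ T +_{x′,y′} C with C a circle, and y is a vertex of degree 2 either
-- of T or of C; it is not the attachment point x′ resp. y′, since attaching raises the degree
-- of that point to 3.  Joins reassociate: in the first case
-- T₁ +_{x,y} T₂ ≅ (T₁ +_{x,y} T) +_{x′,y′} C, a circle-tree (by induction) grown by C; in the
-- second, after swapping the factors of T₂, T₁ +_{x,y} T₂ ≅ (T₁ +_{x,y} C) +_{y′,x′} T, which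
-- is the induction hypothesis for T applied to the circle-tree T₁ +_{x,y} C.  Being a
-- circle-tree is invariant under isomorphism.
module Submission where

open import Defs
open import Relation.Binary.PropositionalEquality using (_≡_)
open import Relation.Binary.PropositionalEquality
  using (refl; trans; cong; cong₂; subst; subst₂; _≢_; ≢-sym; module ≡-Reasoning)
  renaming (sym to ≡-sym)
open import Data.Nat using (ℕ; zero; suc; _+_; _<_; >-nonZero⁻¹)
open import Data.Nat.Properties using (+-assoc; +-comm; +-identityʳ; 1+n≢n; +-0-commutativeMonoid)
open import Data.Nat.ListAction using () renaming (sum to sumˡ)
open import Data.Bool using (Bool; true; false; _∧_; if_then_else_)
open import Data.Bool.Properties using (∧-comm; ∧-zeroʳ)
open import Data.Fin using (Fin; zero; suc; _↑ˡ_; _↑ʳ_; splitAt; fromℕ<; _≟_)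
import Data.Fin as Fin
open import Data.Fin.Properties
  using ( nonZeroIndex; suc-injective; ↑ˡ-injective; ↑ʳ-injective
        ; splitAt-↑ˡ; splitAt-↑ʳ; splitAt-join; join-splitAt )
open import Data.Fin.Permutation using (permutation)
open import Data.List using (tabulate)
open import Data.List.Properties using (map-tabulate)
open import Data.Product using (_,_; proj₂)
open import Data.Sum using (_⊎_; inj₁; inj₂; [_,_]′)
open import Function using (_∘_; id)
open import Function.Definitions using (Injective)
open import Relation.Nullary using (Dec; yes; no; ¬_)
open import Relation.Nullary.Decidable using (⌊_⌋; isYes≗does; dec-true; dec-false)
open import Algebra.Properties.CommutativeMonoid.Sum +-0-commutativeMonoid
  using (sum; sum-cong-≗; sum-permute; sum-replicate-zero)

open _≅_

𝟙 : Bool → ℕ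
𝟙 b = if b then 1 else 0

⌊⌋-true : ∀ {A : Set} (a? : Dec A) → A → ⌊ a? ⌋ ≡ true
⌊⌋-true a? a = trans (isYes≗does a?) (dec-true a? a)

⌊⌋-false : ∀ {A : Set} (a? : Dec A) → ¬ A → ⌊ a? ⌋ ≡ false
⌊⌋-false a? ¬a = trans (isYes≗does a?) (dec-false a? ¬a)

≟-injective : ∀ {m n} {f : Fin m → Fin n} → Injective _≡_ _≡_ f →
              ∀ i j → ⌊ f i ≟ f j ⌋ ≡ ⌊ i ≟ j ⌋
≟-injective {f = f} f-inj i j with i ≟ j
... | yes refl = ⌊⌋-true (f i ≟ f i) refl
... | no i≢j   = ⌊⌋-false (f i ≟ f j) (i≢j ∘ f-inj)

sumˡ-tabulate : ∀ {n} (f : Fin n → ℕ) → sumˡ (tabulate f) ≡ sum f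
sumˡ-tabulate {zero}  f = refl
sumˡ-tabulate {suc n} f = cong (f zero +_) (sumˡ-tabulate (f ∘ suc))

deg≡sum : ∀ G v → deg G v ≡ sum (λ w → 𝟙 (adj G v w))
deg≡sum G v = trans (cong sumˡ (map-tabulate id (𝟙 ∘ adj G v))) (sumˡ-tabulate (𝟙 ∘ adj G v))

sum-↑ : ∀ m {n} (f : Fin (m + n) → ℕ) → sum f ≡ sum (f ∘ (_↑ˡ n)) + sum (f ∘ (m ↑ʳ_))
sum-↑ zero    f = refl
sum-↑ (suc m) f = trans (cong (f zero +_) (sum-↑ m (f ∘ suc))) (≡-sym (+-assoc (f zero) _ _))

sum-𝟙-≟ : ∀ {n} (b : Fin n) → sum (λ w → 𝟙 ⌊ w ≟ b ⌋) ≡ 1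
sum-𝟙-≟ {suc n} zero    = cong suc (sum-replicate-zero n)
sum-𝟙-≟ {suc n} (suc b) =
  trans (sum-cong-≗ (λ w → cong 𝟙 (≟-injective suc-injective w b))) (sum-𝟙-≟ b)

sum-𝟙-∧-≟ : ∀ {n} c (b : Fin n) → sum (λ w → 𝟙 (c ∧ ⌊ w ≟ b ⌋)) ≡ 𝟙 c
sum-𝟙-∧-≟     true  b = sum-𝟙-≟ b
sum-𝟙-∧-≟ {n} false b = sum-replicate-zero n

≅-refl : ∀ {G} → G ≅ G
≅-refl = record
  { to = id ; from = id ; from-to = λ _ → refl ; to-from = λ _ → refl ; adj-pres = λ _ _ → refl }

≅-sym : ∀ {G H} → G ≅ H → H ≅ G
≅-sym {H = H} φ = record
  { to = from φ ; from = to φ ; from-to = to-from φ ; to-from = from-to φ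
  ; adj-pres = λ u v → trans (≡-sym (adj-pres φ (from φ u) (from φ v)))
                             (cong₂ (adj H) (to-from φ u) (to-from φ v)) }

≅-trans : ∀ {G H K} → G ≅ H → H ≅ K → G ≅ K
≅-trans φ ψ = record
  { to = to ψ ∘ to φ ; from = from φ ∘ from ψ
  ; from-to = λ v → trans (cong (from φ) (from-to ψ (to φ v))) (from-to φ v)
  ; to-from = λ w → trans (cong (to ψ) (to-from φ (from ψ w))) (to-from ψ w)
  ; adj-pres = λ u v → trans (adj-pres ψ (to φ u) (to φ v)) (adj-pres φ u v) }

to-injective : ∀ {G H} (φ : G ≅ H) → Injective _≡_ _≡_ (to φ)
to-injective φ {u} {v} eq = trans (≡-sym (from-to φ u)) (trans (cong (from φ) eq) (from-to φ v))

sum-≅ : ∀ {G H} (φ : G ≅ H) (f : Vertex H → ℕ) → sum f ≡ sum (f ∘ to φ)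
sum-≅ φ f = sum-permute f (permutation (to φ) (from φ) (to-from φ) (from-to φ))

deg-≅ : ∀ {G H} (φ : G ≅ H) v → deg H (to φ v) ≡ deg G v
deg-≅ {G} {H} φ v = begin
  deg H (to φ v)                          ≡⟨ deg≡sum H (to φ v) ⟩
  sum (𝟙 ∘ adj H (to φ v))                ≡⟨ sum-≅ φ _ ⟩
  sum (λ w → 𝟙 (adj H (to φ v) (to φ w))) ≡⟨ sum-cong-≗ (cong 𝟙 ∘ adj-pres φ v) ⟩
  sum (𝟙 ∘ adj G v)                       ≡⟨ deg≡sum G v ⟨
  deg G v                                 ∎
  where open ≡-Reasoning

Reachable-≅ : ∀ {G H} (φ : G ≅ H) {u v} → Reachable G u v → Reachable H (to φ u) (to φ v)
Reachable-≅ φ here       = here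
Reachable-≅ φ (step e r) = step (trans (adj-pres φ _ _) e) (Reachable-≅ φ r)

IsCircle-resp-≅ : ∀ {G H} → G ≅ H → IsCircle G → IsCircle H
IsCircle-resp-≅ {G} {H} φ ((0<|G| , reachable) , deg≡2) = (0<|H| , reachable′) , deg≡2′
  where
  0<|H| : 0 < size H
  0<|H| = >-nonZero⁻¹ (size H) ⦃ nonZeroIndex (to φ (fromℕ< 0<|G|)) ⦄
  reachable′ : ∀ u v → Reachable H u v
  reachable′ u v = subst₂ (Reachable H) (to-from φ u) (to-from φ v)
                          (Reachable-≅ φ (reachable (from φ u) (from φ v)))
  deg≡2′ : ∀ v → deg H v ≡ 2
  deg≡2′ v = trans (cong (deg H) (≡-sym (to-from φ v)))
                   (trans (deg-≅ φ (from φ v)) (deg≡2 (from φ v)))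

IsCircleTree-resp-≅ : ∀ {G H} → G ≅ H → IsCircleTree G → IsCircleTree H
IsCircleTree-resp-≅ φ (base c)              = base (IsCircle-resp-≅ φ c)
IsCircleTree-resp-≅ φ (grow T C x y t c d ψ) = grow T C x y t c d (≅-trans (≅-sym φ) ψ)

adj-flip : ∀ {G H} {u v : Vertex G} {u′ v′ : Vertex H} →
           adj G u v ≡ adj H u′ v′ → adj G v u ≡ adj H v′ u′
adj-flip {G} {H} e = trans (sym G _ _) (trans e (sym H _ _))

module Join (A B : Graph) (a : Vertex A) (b : Vertex B) where

  private
    J : Graph
    J = A +[ a , B ] b

  inl : Vertex A → Vertex J
  inl i = i ↑ˡ size B

  inr : Vertex B → Vertex J
  inr j = size A ↑ʳ j

  data View : Vertex J → Set where
    is-inl : ∀ i → View (inl i)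
    is-inr : ∀ j → View (inr j)

  view : ∀ v → View v
  view v = subst View (join-splitAt (size A) (size B) v) (view-⊎ (splitAt (size A) v))
    where
    view-⊎ : ∀ s → View (Fin.join (size A) (size B) s)
    view-⊎ (inj₁ i) = is-inl i
    view-⊎ (inj₂ j) = is-inr j

  cases : ∀ {X : Set} → (Vertex A → X) → (Vertex B → X) → Vertex J → X
  cases f g v = [ f , g ]′ (splitAt (size A) v)

  module _ {X : Set} (f : Vertex A → X) (g : Vertex B → X) where

    cases-inl : ∀ i → cases f g (inl i) ≡ f i
    cases-inl i = cong [ f , g ]′ (splitAt-↑ˡ (size A) i (size B))

    cases-inr : ∀ j → cases f g (inr j) ≡ g j
    cases-inr j = cong [ f , g ]′ (splitAt-↑ʳ (size A) (size B) j)

  inl≢inr : ∀ i j → inl i ≢ inr j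
  inl≢inr i j eq with () ← trans (≡-sym (splitAt-↑ˡ (size A) i (size B)))
                              (trans (cong (splitAt (size A)) eq) (splitAt-↑ʳ (size A) (size B) j))

  ⌊inl≟inl⌋ : ∀ i k → ⌊ inl i ≟ inl k ⌋ ≡ ⌊ i ≟ k ⌋
  ⌊inl≟inl⌋ = ≟-injective (↑ˡ-injective (size B) _ _)

  ⌊inr≟inr⌋ : ∀ j l → ⌊ inr j ≟ inr l ⌋ ≡ ⌊ j ≟ l ⌋
  ⌊inr≟inr⌋ = ≟-injective (↑ʳ-injective (size A) _ _)

  ⌊inl≟inr⌋ : ∀ i j → ⌊ inl i ≟ inr j ⌋ ≡ false
  ⌊inl≟inr⌋ i j = ⌊⌋-false (inl i ≟ inr j) (inl≢inr i j)

  ⌊inr≟inl⌋ : ∀ j i → ⌊ inr j ≟ inl i ⌋ ≡ false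
  ⌊inr≟inl⌋ j i = ⌊⌋-false (inr j ≟ inl i) (inl≢inr i j ∘ ≡-sym)

  adj-inl-inl : ∀ i k → adj J (inl i) (inl k) ≡ adj A i k
  adj-inl-inl i k rewrite splitAt-↑ˡ (size A) i (size B) | splitAt-↑ˡ (size A) k (size B) = refl

  adj-inr-inr : ∀ j l → adj J (inr j) (inr l) ≡ adj B j l
  adj-inr-inr j l rewrite splitAt-↑ʳ (size A) (size B) j | splitAt-↑ʳ (size A) (size B) l = refl

  adj-inl-inr : ∀ i j → adj J (inl i) (inr j) ≡ ⌊ i ≟ a ⌋ ∧ ⌊ j ≟ b ⌋
  adj-inl-inr i j rewrite splitAt-↑ˡ (size A) i (size B) | splitAt-↑ʳ (size A) (size B) j = refl

  adj-inr-inl : ∀ j i → adj J (inr j) (inl i) ≡ ⌊ j ≟ b ⌋ ∧ ⌊ i ≟ a ⌋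
  adj-inr-inl j i = trans (sym J _ _) (trans (adj-inl-inr i j) (∧-comm ⌊ i ≟ a ⌋ _))

  deg-inl : ∀ i → deg J (inl i) ≡ deg A i + 𝟙 ⌊ i ≟ a ⌋
  deg-inl i = begin
    deg J (inl i)                                          ≡⟨ deg≡sum J (inl i) ⟩
    sum (𝟙 ∘ adj J (inl i))                                ≡⟨ sum-↑ (size A) _ ⟩
    sum (𝟙 ∘ adj J (inl i) ∘ inl) + sum (𝟙 ∘ adj J (inl i) ∘ inr)
      ≡⟨ cong₂ _+_ (sum-cong-≗ (cong 𝟙 ∘ adj-inl-inl i))
                   (sum-cong-≗ (cong 𝟙 ∘ adj-inl-inr i)) ⟩
    sum (𝟙 ∘ adj A i) + sum (λ j → 𝟙 (⌊ i ≟ a ⌋ ∧ ⌊ j ≟ b ⌋))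
      ≡⟨ cong₂ _+_ (≡-sym (deg≡sum A i)) (sum-𝟙-∧-≟ _ b) ⟩
    deg A i + 𝟙 ⌊ i ≟ a ⌋                                  ∎
    where open ≡-Reasoning

  deg-inr : ∀ j → deg J (inr j) ≡ 𝟙 ⌊ j ≟ b ⌋ + deg B j
  deg-inr j = begin
    deg J (inr j)                                          ≡⟨ deg≡sum J (inr j) ⟩
    sum (𝟙 ∘ adj J (inr j))                                ≡⟨ sum-↑ (size A) _ ⟩
    sum (𝟙 ∘ adj J (inr j) ∘ inl) + sum (𝟙 ∘ adj J (inr j) ∘ inr)
      ≡⟨ cong₂ _+_ (sum-cong-≗ (cong 𝟙 ∘ adj-inr-inl j))
                   (sum-cong-≗ (cong 𝟙 ∘ adj-inr-inr j)) ⟩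
    sum (λ i → 𝟙 (⌊ j ≟ b ⌋ ∧ ⌊ i ≟ a ⌋)) + sum (𝟙 ∘ adj B j)
      ≡⟨ cong₂ _+_ (sum-𝟙-∧-≟ _ a) (≡-sym (deg≡sum B j)) ⟩
    𝟙 ⌊ j ≟ b ⌋ + deg B j                                  ∎
    where open ≡-Reasoning

  deg-inl-≢ : ∀ {i} → i ≢ a → deg J (inl i) ≡ deg A i
  deg-inl-≢ {i} i≢a = trans (deg-inl i)
    (trans (cong (λ c → deg A i + 𝟙 c) (⌊⌋-false (i ≟ a) i≢a)) (+-identityʳ (deg A i)))

  deg-inr-≢ : ∀ {j} → j ≢ b → deg J (inr j) ≡ deg B j
  deg-inr-≢ {j} j≢b = trans (deg-inr j)
    (cong (λ c → 𝟙 c + deg B j) (⌊⌋-false (j ≟ b) j≢b))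

  deg-inl≡deg-a⇒≢a : ∀ {i} → deg J (inl i) ≡ deg A a → i ≢ a
  deg-inl≡deg-a⇒≢a {i} eq refl = 1+n≢n (begin
    suc (deg A a)          ≡⟨ +-comm 1 (deg A a) ⟩
    deg A a + 𝟙 true       ≡⟨ cong (λ c → deg A a + 𝟙 c) (⌊⌋-true (a ≟ a) refl) ⟨
    deg A a + 𝟙 ⌊ a ≟ a ⌋  ≡⟨ deg-inl a ⟨
    deg J (inl a)          ≡⟨ eq ⟩
    deg A a                ∎)
    where open ≡-Reasoning

  deg-inr≡deg-b⇒≢b : ∀ {j} → deg J (inr j) ≡ deg B b → j ≢ b
  deg-inr≡deg-b⇒≢b {j} eq refl = 1+n≢n (begin
    suc (deg B b)          ≡⟨ cong (λ c → 𝟙 c + deg B b) (⌊⌋-true (b ≟ b) refl) ⟨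
    𝟙 ⌊ b ≟ b ⌋ + deg B b  ≡⟨ deg-inr b ⟨
    deg J (inr b)          ≡⟨ eq ⟩
    deg B b                ∎)
    where open ≡-Reasoning

record IsJoin (G A B : Graph) (a : Vertex A) (b : Vertex B) : Set where
  field
    ιˡ        : Vertex A → Vertex G
    ιʳ        : Vertex B → Vertex G
    split     : Vertex G → Vertex A ⊎ Vertex B
    split-ιˡ  : ∀ i → split (ιˡ i) ≡ inj₁ i
    split-ιʳ  : ∀ j → split (ιʳ j) ≡ inj₂ j
    ι-split   : ∀ v → [ ιˡ , ιʳ ]′ (split v) ≡ v
    adj-ιˡ-ιˡ : ∀ i k → adj G (ιˡ i) (ιˡ k) ≡ adj A i k
    adj-ιʳ-ιʳ : ∀ j l → adj G (ιʳ j) (ιʳ l) ≡ adj B j l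
    adj-ιˡ-ιʳ : ∀ i j → adj G (ιˡ i) (ιʳ j) ≡ ⌊ i ≟ a ⌋ ∧ ⌊ j ≟ b ⌋

IsJoin⇒≅ : ∀ {G A B a b} → IsJoin G A B a b → (A +[ a , B ] b) ≅ G
IsJoin⇒≅ {G} {A} {B} {a} {b} isJoin = record
  { to = to′ ; from = from′ ; from-to = from-to′ ; to-from = to-from′ ; adj-pres = adj-pres′ }
  where
  open IsJoin isJoin
  open Join A B a b

  to′ : Vertex (A +[ a , B ] b) → Vertex G
  to′ = cases ιˡ ιʳ

  from′ : Vertex G → Vertex (A +[ a , B ] b)
  from′ = Fin.join (size A) (size B) ∘ split

  from-to′ : ∀ v → from′ (to′ v) ≡ v
  from-to′ v with view v
  ... | is-inl i = cong (Fin.join _ _) (trans (cong split (cases-inl ιˡ ιʳ i)) (split-ιˡ i))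
  ... | is-inr j = cong (Fin.join _ _) (trans (cong split (cases-inr ιˡ ιʳ j)) (split-ιʳ j))

  to-from′ : ∀ v → to′ (from′ v) ≡ v
  to-from′ v = trans (cong [ ιˡ , ιʳ ]′ (splitAt-join (size A) (size B) (split v))) (ι-split v)

  adj-pres-inl-inr : ∀ i j →
                     adj G (to′ (inl i)) (to′ (inr j)) ≡ adj (A +[ a , B ] b) (inl i) (inr j)
  adj-pres-inl-inr i j = trans (cong₂ (adj G) (cases-inl ιˡ ιʳ i) (cases-inr ιˡ ιʳ j))
                               (trans (adj-ιˡ-ιʳ i j) (≡-sym (adj-inl-inr i j)))

  adj-pres′ : ∀ u v → adj G (to′ u) (to′ v) ≡ adj (A +[ a , B ] b) u v
  adj-pres′ u v with view u | view v
  ... | is-inl i | is-inl k = trans (cong₂ (adj G) (cases-inl ιˡ ιʳ i) (cases-inl ιˡ ιʳ k))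
                                    (trans (adj-ιˡ-ιˡ i k) (≡-sym (adj-inl-inl i k)))
  ... | is-inr j | is-inr l = trans (cong₂ (adj G) (cases-inr ιˡ ιʳ j) (cases-inr ιˡ ιʳ l))
                                    (trans (adj-ιʳ-ιʳ j l) (≡-sym (adj-inr-inr j l)))
  ... | is-inl i | is-inr j = adj-pres-inl-inr i j
  ... | is-inr j | is-inl i = adj-flip {G} {A +[ a , B ] b} (adj-pres-inl-inr i j)

join-congʳ : ∀ A (a : Vertex A) {B B′ b b′} (φ : B ≅ B′) → to φ b ≡ b′ →
             (A +[ a , B ] b) ≅ (A +[ a , B′ ] b′)
join-congʳ A a {B} {B′} {b} φ refl = IsJoin⇒≅ (record
  { ιˡ = inl ; ιʳ = inr ∘ to φ ; split = split
  ; split-ιˡ = cases-inl inj₁ (inj₂ ∘ from φ)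
  ; split-ιʳ = λ j → trans (cases-inr inj₁ (inj₂ ∘ from φ) (to φ j))
                           (cong inj₂ (from-to φ j))
  ; ι-split = ι-split
  ; adj-ιˡ-ιˡ = adj-inl-inl
  ; adj-ιʳ-ιʳ = λ j l → trans (adj-inr-inr (to φ j) (to φ l)) (adj-pres φ j l)
  ; adj-ιˡ-ιʳ = λ i j → trans (adj-inl-inr i (to φ j))
                              (cong (⌊ i ≟ a ⌋ ∧_) (≟-injective (to-injective φ) j b)) })
  where
  open Join A B′ a (to φ b)

  split : Vertex (A +[ a , B′ ] to φ b) → Vertex A ⊎ Vertex B
  split = cases inj₁ (inj₂ ∘ from φ)

  ι-split : ∀ v → [ inl , inr ∘ to φ ]′ (split v) ≡ v
  ι-split v with view v
  ... | is-inl i = cong [ inl , inr ∘ to φ ]′ (cases-inl inj₁ (inj₂ ∘ from φ) i)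
  ... | is-inr j = trans (cong [ inl , inr ∘ to φ ]′ (cases-inr inj₁ (inj₂ ∘ from φ) j))
                         (cong inr (to-from φ j))

join-comm : ∀ A B (a : Vertex A) (b : Vertex B) → (A +[ a , B ] b) ≅ (B +[ b , A ] a)
join-comm A B a b = IsJoin⇒≅ (record
  { ιˡ = inr ; ιʳ = inl ; split = cases inj₂ inj₁
  ; split-ιˡ = cases-inr inj₂ inj₁ ; split-ιʳ = cases-inl inj₂ inj₁
  ; ι-split = ι-split
  ; adj-ιˡ-ιˡ = adj-inr-inr ; adj-ιʳ-ιʳ = adj-inl-inl ; adj-ιˡ-ιʳ = adj-inr-inl })
  where
  open Join B A b a

  ι-split : ∀ v → [ inr , inl ]′ (cases inj₂ inj₁ v) ≡ v
  ι-split v with view v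
  ... | is-inl j = cong [ inr , inl ]′ (cases-inl inj₂ inj₁ j)
  ... | is-inr i = cong [ inr , inl ]′ (cases-inr inj₂ inj₁ i)

to-join-comm-inr : ∀ A B (a : Vertex A) (b : Vertex B) j →
                   to (join-comm A B a b) (Join.inr A B a b j) ≡ Join.inl B A b a j
to-join-comm-inr A B a b = Join.cases-inr A B a b (Join.inr B A b a) (Join.inl B A b a)

join-assoc : ∀ T A B (x : Vertex T) (a : Vertex A) (b : Vertex B) (u : Vertex A) →
             (T +[ x , A +[ a , B ] b ] Join.inl A B a b u) ≅
             ((T +[ x , A ] u) +[ Join.inr T A x u a , B ] b)
join-assoc T A B x a b u = IsJoin⇒≅ (record
  { ιˡ = ιˡ ; ιʳ = ιʳ ; split = split
  ; split-ιˡ = split-inl-inl ; split-ιʳ = split-ιʳ ; ι-split = ι-split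
  ; adj-ιˡ-ιˡ = λ t t′ → trans (R.adj-inl-inl (TA.inl t) (TA.inl t′)) (TA.adj-inl-inl t t′)
  ; adj-ιʳ-ιʳ = adj-ιʳ-ιʳ ; adj-ιˡ-ιʳ = adj-ιˡ-ιʳ })
  where
  module AB = Join A B a b
  module TA = Join T A x u
  module R  = Join (T +[ x , A ] u) B (TA.inr a) b
  G : Graph
  G = (T +[ x , A ] u) +[ TA.inr a , B ] b

  ιˡ : Vertex T → Vertex G
  ιˡ = R.inl ∘ TA.inl

  ιʳ : Vertex (A +[ a , B ] b) → Vertex G
  ιʳ = AB.cases (R.inl ∘ TA.inr) R.inr

  split : Vertex G → Vertex T ⊎ Vertex (A +[ a , B ] b)
  split = R.cases (TA.cases inj₁ (inj₂ ∘ AB.inl)) (inj₂ ∘ AB.inr)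

  split-inl-inl : ∀ t → split (R.inl (TA.inl t)) ≡ inj₁ t
  split-inl-inl t = trans (R.cases-inl _ _ (TA.inl t)) (TA.cases-inl _ _ t)

  split-inl-inr : ∀ a′ → split (R.inl (TA.inr a′)) ≡ inj₂ (AB.inl a′)
  split-inl-inr a′ = trans (R.cases-inl _ _ (TA.inr a′)) (TA.cases-inr _ _ a′)

  ιʳ-inl : ∀ a′ → ιʳ (AB.inl a′) ≡ R.inl (TA.inr a′)
  ιʳ-inl = AB.cases-inl _ _

  ιʳ-inr : ∀ b′ → ιʳ (AB.inr b′) ≡ R.inr b′
  ιʳ-inr = AB.cases-inr _ _

  split-ιʳ : ∀ w → split (ιʳ w) ≡ inj₂ w
  split-ιʳ w with AB.view w
  ... | AB.is-inl a′ = trans (cong split (ιʳ-inl a′)) (split-inl-inr a′)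
  ... | AB.is-inr b′ = trans (cong split (ιʳ-inr b′)) (R.cases-inr _ _ b′)

  ι-split : ∀ v → [ ιˡ , ιʳ ]′ (split v) ≡ v
  ι-split v with R.view v
  ... | R.is-inr b′ = trans (cong [ ιˡ , ιʳ ]′ (R.cases-inr _ _ b′)) (ιʳ-inr b′)
  ... | R.is-inl m with TA.view m
  ...   | TA.is-inl t  = cong [ ιˡ , ιʳ ]′ (split-inl-inl t)
  ...   | TA.is-inr a′ = trans (cong [ ιˡ , ιʳ ]′ (split-inl-inr a′)) (ιʳ-inl a′)

  adj-ιʳ-inl-inr : ∀ a′ b′ → adj G (ιʳ (AB.inl a′)) (ιʳ (AB.inr b′)) ≡
                             adj (A +[ a , B ] b) (AB.inl a′) (AB.inr b′)
  adj-ιʳ-inl-inr a′ b′ = begin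
    adj G (ιʳ (AB.inl a′)) (ιʳ (AB.inr b′))
      ≡⟨ cong₂ (adj G) (ιʳ-inl a′) (ιʳ-inr b′) ⟩
    adj G (R.inl (TA.inr a′)) (R.inr b′)
      ≡⟨ R.adj-inl-inr (TA.inr a′) b′ ⟩
    ⌊ TA.inr a′ ≟ TA.inr a ⌋ ∧ ⌊ b′ ≟ b ⌋
      ≡⟨ cong (_∧ ⌊ b′ ≟ b ⌋) (TA.⌊inr≟inr⌋ a′ a) ⟩
    ⌊ a′ ≟ a ⌋ ∧ ⌊ b′ ≟ b ⌋
      ≡⟨ AB.adj-inl-inr a′ b′ ⟨
    adj (A +[ a , B ] b) (AB.inl a′) (AB.inr b′) ∎
    where open ≡-Reasoning

  adj-ιʳ-ιʳ : ∀ w w′ → adj G (ιʳ w) (ιʳ w′) ≡ adj (A +[ a , B ] b) w w′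
  adj-ιʳ-ιʳ w w′ with AB.view w | AB.view w′
  ... | AB.is-inl a′ | AB.is-inl a″ =
    trans (cong₂ (adj G) (ιʳ-inl a′) (ιʳ-inl a″))
          (trans (R.adj-inl-inl (TA.inr a′) (TA.inr a″))
                 (trans (TA.adj-inr-inr a′ a″) (≡-sym (AB.adj-inl-inl a′ a″))))
  ... | AB.is-inr b′ | AB.is-inr b″ =
    trans (cong₂ (adj G) (ιʳ-inr b′) (ιʳ-inr b″))
          (trans (R.adj-inr-inr b′ b″) (≡-sym (AB.adj-inr-inr b′ b″)))
  ... | AB.is-inl a′ | AB.is-inr b′ = adj-ιʳ-inl-inr a′ b′
  ... | AB.is-inr b′ | AB.is-inl a′ = adj-flip {G} {A +[ a , B ] b} (adj-ιʳ-inl-inr a′ b′)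

  adj-ιˡ-ιʳ : ∀ t w → adj G (ιˡ t) (ιʳ w) ≡ ⌊ t ≟ x ⌋ ∧ ⌊ w ≟ AB.inl u ⌋
  adj-ιˡ-ιʳ t w with AB.view w
  ... | AB.is-inl a′ = begin
    adj G (ιˡ t) (ιʳ (AB.inl a′))                 ≡⟨ cong (adj G (ιˡ t)) (ιʳ-inl a′) ⟩
    adj G (R.inl (TA.inl t)) (R.inl (TA.inr a′))  ≡⟨ R.adj-inl-inl _ _ ⟩
    adj (T +[ x , A ] u) (TA.inl t) (TA.inr a′)   ≡⟨ TA.adj-inl-inr t a′ ⟩
    ⌊ t ≟ x ⌋ ∧ ⌊ a′ ≟ u ⌋
      ≡⟨ cong (⌊ t ≟ x ⌋ ∧_) (AB.⌊inl≟inl⌋ a′ u) ⟨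
    ⌊ t ≟ x ⌋ ∧ ⌊ AB.inl a′ ≟ AB.inl u ⌋          ∎
    where open ≡-Reasoning
  ... | AB.is-inr b′ = begin
    adj G (ιˡ t) (ιʳ (AB.inr b′))         ≡⟨ cong (adj G (ιˡ t)) (ιʳ-inr b′) ⟩
    adj G (R.inl (TA.inl t)) (R.inr b′)   ≡⟨ R.adj-inl-inr _ _ ⟩
    ⌊ TA.inl t ≟ TA.inr a ⌋ ∧ ⌊ b′ ≟ b ⌋  ≡⟨ cong (_∧ ⌊ b′ ≟ b ⌋) (TA.⌊inl≟inr⌋ t a) ⟩
    false                                 ≡⟨ ∧-zeroʳ ⌊ t ≟ x ⌋ ⟨
    ⌊ t ≟ x ⌋ ∧ false                     ≡⟨ cong (⌊ t ≟ x ⌋ ∧_) (AB.⌊inr≟inl⌋ b′ u) ⟨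
    ⌊ t ≟ x ⌋ ∧ ⌊ AB.inr b′ ≟ AB.inl u ⌋  ∎
    where open ≡-Reasoning

IsCircleTree-join : ∀ {T₂} → IsCircleTree T₂ →
                    ∀ {T₁} (x : Vertex T₁) (y : Vertex T₂) → IsCircleTree T₁ →
                    deg T₁ x ≡ 2 → deg T₂ y ≡ 2 → IsCircleTree (T₁ +[ x , T₂ ] y)
IsCircleTree-join (base C-circle) x y T₁-tree x-deg _ = grow _ _ x y T₁-tree C-circle x-deg ≅-refl
IsCircleTree-join (grow T C x′ y′ T-tree C-circle x′-deg ψ) {T₁} x y T₁-tree x-deg y-deg =
  IsCircleTree-resp-≅ (≅-sym (join-congʳ T₁ x ψ refl))
                      (attach (view (to ψ y)) (trans (deg-≅ ψ y) y-deg))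
  where
  open Join T C x′ y′

  attach : ∀ {v} → View v → deg (T +[ x′ , C ] y′) v ≡ 2 →
           IsCircleTree (T₁ +[ x , T +[ x′ , C ] y′ ] v)
  attach (is-inl i) i-deg =
    grow (T₁ +[ x , T ] i) C (Join.inr T₁ T x i x′) y′ T₁T-tree C-circle x′-deg′
         (join-assoc T₁ T C x x′ y′ i)
    where
    i≢x′ : i ≢ x′
    i≢x′ = deg-inl≡deg-a⇒≢a (trans i-deg (≡-sym x′-deg))
    T₁T-tree : IsCircleTree (T₁ +[ x , T ] i)
    T₁T-tree = IsCircleTree-join T-tree x i T₁-tree x-deg (trans (≡-sym (deg-inl-≢ i≢x′)) i-deg)
    x′-deg′ : deg (T₁ +[ x , T ] i) (Join.inr T₁ T x i x′) ≡ 2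
    x′-deg′ = trans (Join.deg-inr-≢ T₁ T x i (≢-sym i≢x′)) x′-deg
  attach (is-inr j) j-deg =
    IsCircleTree-resp-≅ (≅-sym (≅-trans swap (join-assoc T₁ C T x y′ x′ j))) T₁CT-tree
    where
    j≢y′ : j ≢ y′
    j≢y′ = deg-inr≡deg-b⇒≢b (trans j-deg (≡-sym (proj₂ C-circle y′)))
    swap : (T₁ +[ x , T +[ x′ , C ] y′ ] inr j) ≅
           (T₁ +[ x , C +[ y′ , T ] x′ ] Join.inl C T y′ x′ j)
    swap = join-congʳ T₁ x (join-comm T C x′ y′) (to-join-comm-inr T C x′ y′ j)
    y′-deg′ : deg (T₁ +[ x , C ] j) (Join.inr T₁ C x j y′) ≡ 2
    y′-deg′ = trans (Join.deg-inr-≢ T₁ C x j (≢-sym j≢y′)) (proj₂ C-circle y′)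
    T₁CT-tree : IsCircleTree ((T₁ +[ x , C ] j) +[ Join.inr T₁ C x j y′ , T ] x′)
    T₁CT-tree = IsCircleTree-join T-tree (Join.inr T₁ C x j y′) x′
                  (grow T₁ C x j T₁-tree C-circle x-deg ≅-refl) y′-deg′ x′-deg

lemma4p16 : (T₁ T₂ : Graph) (x : Vertex T₁) (y : Vertex T₂) →
            IsCircleTree T₁ → IsCircleTree T₂ →
            deg T₁ x ≡ 2 → deg T₂ y ≡ 2 →
            IsCircleTree (T₁ +[ x , T₂ ] y)
lemma4p16 T₁ T₂ x y T₁-tree T₂-tree = IsCircleTree-join T₂-tree x y T₁-tree
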